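{- The $\mathbb{K}$-span $\mathfrak{TC}$ of the elements $\mathcal{M}_{\mathbf{I}}$, $\mathbf{I}$ running over segmented compositions, is closed under the $\#$ product.
   Context: Let $A=\{a_1<a_2<\cdots\}$ be an infinite totally ordered alphabet (identified with $\{1<2<\cdots\}$) and $\mathbb{K}$ a field; work with formal $\mathbb{K}$-linear combinations of nonempty words over $A$. The $\#$ product of words is $(ux)\#(yv)=uxv$ if the letters $x,y$ are equal and $0$ otherwise ($u,v$ words, $x,y$ letters), extended bilinearly. A segmented composition of $n$ is a finite sequence of positive integers summing to $n$, consecutive entries being separated either by a comma or by a vertical bar (e.g. $(2,1\,|\,2\,|\,1,2)$). Segmented compositions of $n$ are in bijection with sequences $s_1\cdots s_{n-1}$ over $\{<,=,>\}$: $s_i$ is $<$ if $i$ is not a partial sum of the entries, $=$ if $i$ is a partial sum at which the separator is a comma, and $>$ if it is a partial sum at which the separator is a bar. For a word $w$ of length $n$, $S(w)$ is the segmented composition whose sequence is $s_i=$ the comparison sign between $w_i$ and $w_{i+1}$. For a segmented composition $\mathbf{I}$ of $n$, $\mathcal{M}_{\mathbf{I}}$ is the sum of all words $w$ of length $n$ over $A$ with $S(w)=\mathbf{I}$. -}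

module Defs where

open import Level using (Level; _⊔_) renaming (suc to lsuc)
open import Algebra.Bundles using (CommutativeRing)
open import Data.Nat using (ℕ; zero; suc; _<_; _≤_) renaming (_+_ to _+ℕ_)
open import Data.Nat.Properties using (<-cmp)
open import Data.List using (List; []; _∷_; foldr; _++_; [_]; map)
open import Data.List.NonEmpty using (List⁺; _∷_)
open import Data.Product using (Σ; _×_; _,_; ∃)
open import Relation.Nullary using (¬_; yes; no)
open import Relation.Binary using (Tri; tri<; tri≈; tri>)
open import Relation.Binary.PropositionalEquality using (_≡_)
import Data.Bool
import Data.List.NonEmpty

record Field (c ℓ : Level) : Set (lsuc (c ⊔ ℓ)) where
  field
    commutativeRing : CommutativeRing c ℓ
  open CommutativeRing commutativeRing public
  field
    0≉1     : ¬ (0# ≈ 1#)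
    inverse : ∀ x → ¬ (x ≈ 0#) → ∃ λ y → (x * y) ≈ 1#

-- Alphabet: the letters a₁ < a₂ < ⋯ are represented by ℕ with its usual
-- order (0 < 1 < 2 < ⋯, order-isomorphic to 1 < 2 < ⋯).

Letter : Set
Letter = ℕ

Word : Set
Word = List⁺ Letter

data Sign : Set where
  lt eq gt : Sign

cmpSign : Letter → Letter → Sign
cmpSign x y with <-cmp x y
... | tri< _ _ _ = lt
... | tri≈ _ _ _ = eq
... | tri> _ _ _ = gt

signsFrom : Letter → List Letter → List Sign
signsFrom x []       = []
signsFrom x (y ∷ ys) = cmpSign x y ∷ signsFrom y ys

wordSigns : Word → List Sign
wordSigns (x ∷ xs) = signsFrom x xs

-- Segmented compositions: a first positive part, followed by a list of
-- (separator, positive part).  A positive integer k is encoded as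
-- `suc k'` by storing k' = k - 1.

data Separator : Set where
  comma bar : Separator

record SegComp : Set where
  constructor segComp
  field
    firstPart : ℕ                       -- first entry minus 1
    rest      : List (Separator × ℕ)    -- (separator, entry minus 1)

ltRun : ℕ → List Sign
ltRun zero    = []
ltRun (suc k) = lt ∷ ltRun k

sepSign : Separator → Sign
sepSign comma = eq
sepSign bar   = gt

-- The bijection with sequences over {<,=,>}: inside a part the sign is <,
-- at a partial sum it is = (comma) or > (bar).
restSigns : List (Separator × ℕ) → List Sign
restSigns []             = []
restSigns ((s , k) ∷ ps) = sepSign s ∷ (ltRun k ++ restSigns ps)

segSigns : SegComp → List Sign
segSigns (segComp k ps) = ltRun k ++ restSigns ps

-- Formal (possibly infinite) K-linear combinations of nonempty words,
-- given by their coefficient functions; M_I and the # product.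

module Series {c ℓ} (K : Field c ℓ) where
  open Field K

  Ser : Set c
  Ser = Word → Carrier

  sign≟ : Sign → Sign → Data.Bool.Bool
  sign≟ lt lt = Data.Bool.true
  sign≟ eq eq = Data.Bool.true
  sign≟ gt gt = Data.Bool.true
  sign≟ _  _  = Data.Bool.false

  signs≟ : List Sign → List Sign → Data.Bool.Bool
  signs≟ []       []       = Data.Bool.true
  signs≟ (a ∷ as) (b ∷ bs) = Data.Bool._∧_ (sign≟ a b) (signs≟ as bs)
  signs≟ _        _        = Data.Bool.false

  -- M_I = Σ { w : S(w) = I }
  M : SegComp → Ser
  M I w = Data.Bool.if signs≟ (wordSigns w) (segSigns I) then 1# else 0#

  -- For words, a # b = w iff a = w₁⋯wᵢ and
  -- b = wᵢ⋯wₘ for some 1 ≤ i ≤ m (these pairs are distinct), hence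
  --   (f # g)(w) = Σ_{i=1}^{m} f(w₁⋯wᵢ) · g(wᵢ⋯wₘ).
  -- sharpAux f g u x v : sum over splittings of (u ++ x ∷ v) with the
  -- shared letter at x or later, where u is the reversed prefix before x.
  sharpAux : Ser → Ser → List Letter → Letter → List Letter → Carrier
  sharpAux f g u x []       = f (Data.List.NonEmpty.reverse (x ∷ u)) * g (x ∷ [])
  sharpAux f g u x (y ∷ v) =
    (f (Data.List.NonEmpty.reverse (x ∷ u)) * g (x ∷ (y ∷ v)))
      + sharpAux f g (x ∷ u) y v

  _#_ : Ser → Ser → Ser
  (f # g) (x ∷ v) = sharpAux f g [] x v

  lincomb : List (Carrier × SegComp) → Ser
  lincomb []             w = 0#
  lincomb ((a , I) ∷ ts) w = (a * M I w) + lincomb ts w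

  InTC : Ser → Set (c ⊔ ℓ)
  InTC f = ∃ λ (ts : List (Carrier × SegComp)) → ∀ w → f w ≈ lincomb ts w

-- Each M_I is the indicator series of the words whose sign sequence is that of I.  A word w
-- of length m factors as w = a # b in exactly the m ways a = w₁⋯wᵢ, b = wᵢ⋯wₘ, and the sign
-- sequence of w is then the concatenation of those of a and b.  Hence in (M_I # M_J)(w) only
-- the split with |a| = |I| survives, and it contributes 1 exactly when the signs of w are
-- those of I followed by those of J: M_I # M_J = M_{I·J}, where I·J is the segmented
-- composition with that concatenated sign sequence.  Since # is bilinear, the span of the
-- M_I is closed under #.
module Submission where

open import Defs
open import Data.Nat using (suc; pred; _≤_; _<_; z≤n; s≤s)
open import Data.Nat.Properties
  using (_≟_; <⇒≢; ≤∧≢⇒<; m<n⇒m<1+n; ≤-reflexive; <-≤-trans)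
open import Data.List using (List; []; _∷_; _++_; [_]; _∷ʳ_; map; concatMap; length; reverse)
open import Data.List.Properties using (length-++-≤ˡ; length-reverse; unfold-reverse; ++-assoc)
open import Data.List.NonEmpty as List⁺ using (_∷_)
import Data.Vec as Vec
open import Data.Vec.Properties using (toList-reverse; toList∘fromList)
open import Data.Bool using (Bool; true; false; _∧_; if_then_else_)
open import Data.Bool.Properties using (∧-assoc; ∧-zeroʳ)
open import Data.Product using (_×_; _,_)
open import Data.Empty using (⊥-elim)
open import Relation.Nullary using (yes; no)
open import Relation.Binary.PropositionalEquality
  using (_≡_; _≢_; refl; cong) renaming (sym to ≡-sym; trans to ≡-trans)
open import Function using (_∘_)

signs : List Letter → List Sign
signs []       = []
signs (x ∷ xs) = signsFrom x xs

length-signsFrom : ∀ x xs → length (signsFrom x xs) ≡ length xs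
length-signsFrom x []       = refl
length-signsFrom x (y ∷ xs) = cong suc (length-signsFrom y xs)

length-signs : ∀ xs → length (signs xs) ≡ pred (length xs)
length-signs []       = refl
length-signs (x ∷ xs) = length-signsFrom x xs

length-signs-reverse : ∀ x u → length (signs (reverse (x ∷ u))) ≡ length u
length-signs-reverse x u = ≡-trans (length-signs (reverse (x ∷ u)))
                                   (cong pred (length-reverse (x ∷ u)))

signsFrom-++-∷ : ∀ y p x q → signsFrom y (p ++ x ∷ q) ≡ signsFrom y (p ∷ʳ x) ++ signsFrom x q
signsFrom-++-∷ y []      x q = refl
signsFrom-++-∷ y (z ∷ p) x q = cong (cmpSign y z ∷_) (signsFrom-++-∷ z p x q)

signs-++-∷ : ∀ p x q → signs (p ++ x ∷ q) ≡ signs (p ∷ʳ x) ++ signsFrom x q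
signs-++-∷ []      x q = refl
signs-++-∷ (y ∷ p) x q = signsFrom-++-∷ y p x q

wordSigns-reverse : ∀ x u → wordSigns (List⁺.reverse (x ∷ u)) ≡ signs (reverse (x ∷ u))
wordSigns-reverse x u = cong signs (≡-trans (toList-fromVec (Vec.reverse (Vec.fromList (x ∷ u))))
  (≡-trans (toList-reverse (Vec.fromList (x ∷ u))) (cong reverse (toList∘fromList (x ∷ u)))))
  where
  toList-fromVec : ∀ {n} (v : Vec.Vec Letter (suc n)) → List⁺.toList (List⁺.fromVec v) ≡ Vec.toList v
  toList-fromVec (y Vec.∷ ys) = refl

reverse-∷-++ : ∀ x u (v : List Letter) → reverse (x ∷ u) ++ v ≡ reverse u ++ x ∷ v
reverse-∷-++ x u v = ≡-trans (cong (_++ v) (unfold-reverse x u)) (++-assoc (reverse u) [ x ] v)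

prependLt : SegComp → SegComp
prependLt (segComp k ps) = segComp (suc k) ps

prependSeparator : Separator → SegComp → SegComp
prependSeparator s (segComp k ps) = segComp 0 ((s , k) ∷ ps)

fromSigns : List Sign → SegComp
fromSigns []       = segComp 0 []
fromSigns (lt ∷ l) = prependLt (fromSigns l)
fromSigns (eq ∷ l) = prependSeparator comma (fromSigns l)
fromSigns (gt ∷ l) = prependSeparator bar (fromSigns l)

segSigns-prependLt : ∀ I → segSigns (prependLt I) ≡ lt ∷ segSigns I
segSigns-prependLt (segComp k ps) = refl

segSigns-prependSeparator : ∀ s I → segSigns (prependSeparator s I) ≡ sepSign s ∷ segSigns I
segSigns-prependSeparator s (segComp k ps) = refl

segSigns-fromSigns : ∀ l → segSigns (fromSigns l) ≡ l
segSigns-fromSigns [] = refl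
segSigns-fromSigns (lt ∷ l) =
  ≡-trans (segSigns-prependLt (fromSigns l)) (cong (lt ∷_) (segSigns-fromSigns l))
segSigns-fromSigns (eq ∷ l) =
  ≡-trans (segSigns-prependSeparator comma (fromSigns l)) (cong (eq ∷_) (segSigns-fromSigns l))
segSigns-fromSigns (gt ∷ l) =
  ≡-trans (segSigns-prependSeparator bar (fromSigns l)) (cong (gt ∷_) (segSigns-fromSigns l))

_·_ : SegComp → SegComp → SegComp
I · J = fromSigns (segSigns I ++ segSigns J)

module SeriesProperties {c ℓ} (K : Field c ℓ) where
  open Series K
  open Field K renaming (refl to ≈-refl)
  open import Algebra.Properties.CommutativeSemigroup +-commutativeSemigroup using (interchange)
  open import Algebra.Properties.CommutativeSemigroup *-commutativeSemigroup using (x∙yz≈y∙xz)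
  open import Relation.Binary.Reasoning.Setoid setoid

  signs≟-≢-length : ∀ a b → length a ≢ length b → signs≟ a b ≡ false
  signs≟-≢-length []      []      a≢b = ⊥-elim (a≢b refl)
  signs≟-≢-length []      (_ ∷ _) _   = refl
  signs≟-≢-length (_ ∷ _) []      _   = refl
  signs≟-≢-length (x ∷ a) (y ∷ b) a≢b =
    ≡-trans (cong (sign≟ x y ∧_) (signs≟-≢-length a b (a≢b ∘ cong suc))) (∧-zeroʳ _)

  signs≟-++ : ∀ a b c d → length a ≡ length c → signs≟ (a ++ b) (c ++ d) ≡ signs≟ a c ∧ signs≟ b d
  signs≟-++ []      b []      d _ = refl
  signs≟-++ (x ∷ a) b (y ∷ c) d a≡c =
    ≡-trans (cong (sign≟ x y ∧_) (signs≟-++ a b c d (cong pred a≡c)))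
            (≡-sym (∧-assoc (sign≟ x y) _ _))

  𝟙 : Bool → Carrier
  𝟙 b = if b then 1# else 0#

  𝟙-∧ : ∀ p q → 𝟙 p * 𝟙 q ≈ 𝟙 (p ∧ q)
  𝟙-∧ true  true  = *-identityˡ 1#
  𝟙-∧ true  false = zeroʳ 1#
  𝟙-∧ false q     = zeroˡ (𝟙 q)

  -- M I is definitionally hasSigns (segSigns I).
  hasSigns : List Sign → Ser
  hasSigns s w = 𝟙 (signs≟ (wordSigns w) s)

  module _ {o} {A : Set o} where

    weightedSum : List (Carrier × A) → (A → Carrier) → Carrier
    weightedSum []             h = 0#
    weightedSum ((a , i) ∷ ts) h = a * h i + weightedSum ts h

    weightedSum-cong : ∀ ts {h k} → (∀ i → h i ≈ k i) → weightedSum ts h ≈ weightedSum ts k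
    weightedSum-cong []             h≈k = ≈-refl
    weightedSum-cong ((a , i) ∷ ts) h≈k = +-cong (*-congˡ (h≈k i)) (weightedSum-cong ts h≈k)

    weightedSum-+ : ∀ ts h k → weightedSum ts h + weightedSum ts k ≈ weightedSum ts (λ i → h i + k i)
    weightedSum-+ []             h k = +-identityʳ 0#
    weightedSum-+ ((a , i) ∷ ts) h k = begin
      (a * h i + weightedSum ts h) + (a * k i + weightedSum ts k)
        ≈⟨ interchange _ _ _ _ ⟩
      (a * h i + a * k i) + (weightedSum ts h + weightedSum ts k)
        ≈⟨ +-cong (sym (distribˡ a (h i) (k i))) (weightedSum-+ ts h k) ⟩
      a * (h i + k i) + weightedSum ts (λ j → h j + k j) ∎

    weightedSum-*ˡ : ∀ ts h y → y * weightedSum ts h ≈ weightedSum ts (λ i → y * h i)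
    weightedSum-*ˡ []             h y = zeroʳ y
    weightedSum-*ˡ ((a , i) ∷ ts) h y = begin
      y * (a * h i + weightedSum ts h)     ≈⟨ distribˡ y _ _ ⟩
      y * (a * h i) + y * weightedSum ts h ≈⟨ +-cong (x∙yz≈y∙xz y a (h i)) (weightedSum-*ˡ ts h y) ⟩
      a * (y * h i) + weightedSum ts (λ j → y * h j) ∎

    weightedSum-*ʳ : ∀ ts h y → weightedSum ts h * y ≈ weightedSum ts (λ i → h i * y)
    weightedSum-*ʳ ts h y = begin
      weightedSum ts h * y            ≈⟨ *-comm _ y ⟩
      y * weightedSum ts h            ≈⟨ weightedSum-*ˡ ts h y ⟩
      weightedSum ts (λ i → y * h i)  ≈⟨ weightedSum-cong ts (λ i → *-comm y (h i)) ⟩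
      weightedSum ts (λ i → h i * y)  ∎

    weightedSum-++ : ∀ ts ss h → weightedSum (ts ++ ss) h ≈ weightedSum ts h + weightedSum ss h
    weightedSum-++ []             ss h = sym (+-identityˡ _)
    weightedSum-++ ((a , i) ∷ ts) ss h =
      trans (+-congˡ (weightedSum-++ ts ss h)) (sym (+-assoc _ _ _))

  productTerms : ∀ {o} {A : Set o} → (A → A → A) →
                 List (Carrier × A) → List (Carrier × A) → List (Carrier × A)
  productTerms _∙_ ts ss = concatMap (λ (a , i) → map (λ (b , j) → (a * b , i ∙ j)) ss) ts

  weightedSum-productTerms : ∀ {o} {A : Set o} (_∙_ : A → A → A) ts ss h →
    weightedSum ts (λ i → weightedSum ss (λ j → h (i ∙ j))) ≈ weightedSum (productTerms _∙_ ts ss) h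
  weightedSum-productTerms _∙_ []             ss h = ≈-refl
  weightedSum-productTerms _∙_ ((a , i) ∷ ts) ss h = begin
    a * weightedSum ss (λ j → h (i ∙ j)) + weightedSum ts _
      ≈⟨ +-cong (sym (scaledRow ss)) (weightedSum-productTerms _∙_ ts ss h) ⟩
    weightedSum (map (λ (b , j) → (a * b , i ∙ j)) ss) h + weightedSum (productTerms _∙_ ts ss) h
      ≈⟨ sym (weightedSum-++ (map _ ss) _ h) ⟩
    weightedSum (productTerms _∙_ ((a , i) ∷ ts) ss) h ∎
    where
    scaledRow : ∀ ss → weightedSum (map (λ (b , j) → (a * b , i ∙ j)) ss) h
                       ≈ a * weightedSum ss (λ j → h (i ∙ j))
    scaledRow []             = sym (zeroʳ a)
    scaledRow ((b , j) ∷ ss) = trans (+-cong (*-assoc a b _) (scaledRow ss)) (sym (distribˡ a _ _))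

  lincomb-weightedSum : ∀ ts w → lincomb ts w ≡ weightedSum ts (λ I → M I w)
  lincomb-weightedSum []             w = refl
  lincomb-weightedSum ((a , I) ∷ ts) w = cong (a * M I w +_) (lincomb-weightedSum ts w)

  sharpAux-cong : ∀ {f f′ g g′} → (∀ w → f w ≈ f′ w) → (∀ w → g w ≈ g′ w) →
                  ∀ u x v → sharpAux f g u x v ≈ sharpAux f′ g′ u x v
  sharpAux-cong f≈ g≈ u x []      = *-cong (f≈ _) (g≈ _)
  sharpAux-cong f≈ g≈ u x (y ∷ v) = +-cong (*-cong (f≈ _) (g≈ _)) (sharpAux-cong f≈ g≈ (x ∷ u) y v)

  #-cong : ∀ {f f′ g g′} → (∀ w → f w ≈ f′ w) → (∀ w → g w ≈ g′ w) → ∀ w → (f # g) w ≈ (f′ # g′) w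
  #-cong f≈ g≈ (x ∷ v) = sharpAux-cong f≈ g≈ [] x v

  module _ {o} {A : Set o} where

    sharpAux-weightedSumˡ : ∀ ts (h : A → Ser) g u x v →
      sharpAux (λ w → weightedSum ts (λ i → h i w)) g u x v ≈ weightedSum ts (λ i → sharpAux (h i) g u x v)
    sharpAux-weightedSumˡ ts h g u x []      = weightedSum-*ʳ ts _ _
    sharpAux-weightedSumˡ ts h g u x (y ∷ v) =
      trans (+-cong (weightedSum-*ʳ ts _ _) (sharpAux-weightedSumˡ ts h g (x ∷ u) y v))
            (weightedSum-+ ts _ _)

    sharpAux-weightedSumʳ : ∀ ts (h : A → Ser) f u x v →
      sharpAux f (λ w → weightedSum ts (λ i → h i w)) u x v ≈ weightedSum ts (λ i → sharpAux f (h i) u x v)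
    sharpAux-weightedSumʳ ts h f u x []      = weightedSum-*ˡ ts _ _
    sharpAux-weightedSumʳ ts h f u x (y ∷ v) =
      trans (+-cong (weightedSum-*ˡ ts _ _) (sharpAux-weightedSumʳ ts h f (x ∷ u) y v))
            (weightedSum-+ ts _ _)

  module _ (s t : List Sign) where

    splitTerm : List Letter → Letter → List Letter → Carrier
    splitTerm u x v = hasSigns s (List⁺.reverse (x ∷ u)) * hasSigns t (x ∷ v)

    concatenated : List Letter → Letter → List Letter → Carrier
    concatenated u x v = 𝟙 (signs≟ (signs (reverse u ++ x ∷ v)) (s ++ t))

    splitTerm-≡ : ∀ u x v → length u ≡ length s → splitTerm u x v ≈ concatenated u x v
    splitTerm-≡ u x v u≡s = begin
      splitTerm u x v
        ≡⟨ cong (λ p → 𝟙 (signs≟ p s) * _) (wordSigns-reverse x u) ⟩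
      𝟙 (signs≟ (signs (reverse (x ∷ u))) s) * 𝟙 (signs≟ (signsFrom x v) t)
        ≈⟨ 𝟙-∧ _ _ ⟩
      𝟙 (signs≟ (signs (reverse (x ∷ u))) s ∧ signs≟ (signsFrom x v) t)
        ≡⟨ cong 𝟙 (≡-sym (signs≟-++ (signs (reverse (x ∷ u))) (signsFrom x v) s t
                                      (≡-trans (length-signs-reverse x u) u≡s))) ⟩
      𝟙 (signs≟ (signs (reverse (x ∷ u)) ++ signsFrom x v) (s ++ t))
        ≡⟨ cong (λ p → 𝟙 (signs≟ (signs p ++ signsFrom x v) (s ++ t))) (unfold-reverse x u) ⟩
      𝟙 (signs≟ (signs (reverse u ∷ʳ x) ++ signsFrom x v) (s ++ t))
        ≡⟨ cong (λ p → 𝟙 (signs≟ p (s ++ t))) (≡-sym (signs-++-∷ (reverse u) x v)) ⟩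
      concatenated u x v ∎

    splitTerm-≢ : ∀ u x v → length u ≢ length s → splitTerm u x v ≈ 0#
    splitTerm-≢ u x v u≢s = trans (*-congʳ (reflexive (cong 𝟙 prefix-mismatch))) (zeroˡ _)
      where
      prefix-mismatch : signs≟ (wordSigns (List⁺.reverse (x ∷ u))) s ≡ false
      prefix-mismatch rewrite wordSigns-reverse x u =
        signs≟-≢-length (signs (reverse (x ∷ u))) s (u≢s ∘ ≡-trans (≡-sym (length-signs-reverse x u)))

    sharpAux-hasSigns-beyond : ∀ v u x → length s < length u →
                               sharpAux (hasSigns s) (hasSigns t) u x v ≈ 0#
    sharpAux-hasSigns-beyond []      u x s<u = splitTerm-≢ u x [] (<⇒≢ s<u ∘ ≡-sym)
    sharpAux-hasSigns-beyond (y ∷ v) u x s<u =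
      trans (+-cong (splitTerm-≢ u x (y ∷ v) (<⇒≢ s<u ∘ ≡-sym))
                    (sharpAux-hasSigns-beyond v (x ∷ u) y (m<n⇒m<1+n s<u)))
            (+-identityʳ 0#)

    sharpAux-hasSigns : ∀ v u x → length u ≤ length s →
                        sharpAux (hasSigns s) (hasSigns t) u x v ≈ concatenated u x v
    sharpAux-hasSigns v u x u≤s with length u ≟ length s
    sharpAux-hasSigns []      u x u≤s | yes u≡s = splitTerm-≡ u x [] u≡s
    sharpAux-hasSigns (y ∷ v) u x u≤s | yes u≡s =
      trans (+-cong (splitTerm-≡ u x (y ∷ v) u≡s)
                    (sharpAux-hasSigns-beyond v (x ∷ u) y (s≤s (≤-reflexive (≡-sym u≡s)))))
            (+-identityʳ _)
    sharpAux-hasSigns []      u x u≤s | no u≢s =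
      trans (splitTerm-≢ u x [] u≢s)
            (sym (reflexive (cong 𝟙 (signs≟-≢-length (signs (reverse u ∷ʳ x)) (s ++ t) too-short))))
      where
      u<s++t : length u < length (s ++ t)
      u<s++t = <-≤-trans (≤∧≢⇒< u≤s u≢s) (length-++-≤ˡ s)

      length-prefix-signs : length (signs (reverse u ∷ʳ x)) ≡ length u
      length-prefix-signs =
        ≡-trans (cong (length ∘ signs) (≡-sym (unfold-reverse x u))) (length-signs-reverse x u)

      too-short : length (signs (reverse u ∷ʳ x)) ≢ length (s ++ t)
      too-short = <⇒≢ u<s++t ∘ ≡-trans (≡-sym length-prefix-signs)
    sharpAux-hasSigns (y ∷ v) u x u≤s | no u≢s =
      trans (+-cong (splitTerm-≢ u x (y ∷ v) u≢s) (sharpAux-hasSigns v (x ∷ u) y (≤∧≢⇒< u≤s u≢s)))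
            (trans (+-identityˡ _)
                   (reflexive (cong (λ p → 𝟙 (signs≟ (signs p) (s ++ t))) (reverse-∷-++ x u (y ∷ v)))))

  M-# : ∀ I J w → (M I # M J) w ≈ M (I · J) w
  M-# I J (x ∷ v) = trans (sharpAux-hasSigns (segSigns I) (segSigns J) v [] x z≤n)
    (reflexive (cong (λ l → 𝟙 (signs≟ (signsFrom x v) l)) (≡-sym (segSigns-fromSigns _))))

  lincomb-# : ∀ ts ss w → (lincomb ts # lincomb ss) w ≈ lincomb (productTerms _·_ ts ss) w
  lincomb-# ts ss (x ∷ v) = begin
    sharpAux (lincomb ts) (lincomb ss) [] x v
      ≈⟨ sharpAux-cong (reflexive ∘ lincomb-weightedSum ts) (reflexive ∘ lincomb-weightedSum ss) [] x v ⟩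
    sharpAux (λ w → weightedSum ts (λ I → M I w)) (λ w → weightedSum ss (λ J → M J w)) [] x v
      ≈⟨ sharpAux-weightedSumˡ ts M _ [] x v ⟩
    weightedSum ts (λ I → sharpAux (M I) (λ w → weightedSum ss (λ J → M J w)) [] x v)
      ≈⟨ weightedSum-cong ts (λ I → sharpAux-weightedSumʳ ss M (M I) [] x v) ⟩
    weightedSum ts (λ I → weightedSum ss (λ J → (M I # M J) (x ∷ v)))
      ≈⟨ weightedSum-cong ts (λ I → weightedSum-cong ss (λ J → M-# I J (x ∷ v))) ⟩
    weightedSum ts (λ I → weightedSum ss (λ J → M (I · J) (x ∷ v)))
      ≈⟨ weightedSum-productTerms _·_ ts ss (λ L → M L (x ∷ v)) ⟩
    weightedSum (productTerms _·_ ts ss) (λ L → M L (x ∷ v))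
      ≡⟨ ≡-sym (lincomb-weightedSum (productTerms _·_ ts ss) (x ∷ v)) ⟩
    lincomb (productTerms _·_ ts ss) (x ∷ v) ∎

mainTheorem15 : ∀ {c ℓ} (K : Field c ℓ) → let open Series K in
                ∀ (f g : Ser) → InTC f → InTC g → InTC (f # g)
mainTheorem15 K f g (ts , f≈ts) (ss , g≈ss) =
  productTerms _·_ ts ss , λ w → trans (#-cong f≈ts g≈ss w) (lincomb-# ts ss w)
  where open Field K
        open SeriesProperties K
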